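{- Let $q\ge2$, $n\ge1$, and let $\mathbf f\in A_q^+$ be a word whose last symbol is $0$ or $q-1$. Let $\mathbf a=a_1\cdots a_n$ and $\mathbf b=b_1\cdots b_n$ be two words of $A_q^n(\mathbf f)$ that are consecutive in the list of $A_q^n(\mathbf f)$ ordered by $\prec$, or consecutive in the list ordered by $\triangleleft$. If $k$ is the leftmost position where $\mathbf a$ and $\mathbf b$ differ, then $b_k=a_k+1$ or $b_k=a_k-1$.
   Context: $A_q=\{0,1,\dots,q-1\}$; $A_q^n$ is the set of length-$n$ words over $A_q$, $A_q^+$ the nonempty finite words; $A_q^n(\mathbf f)$ is the set of words of $A_q^n$ not containing $\mathbf f$ as a factor (contiguous subword). For distinct words $\mathbf s,\mathbf t$ of equal length, with $k$ the leftmost differing position, $u=\sum_{i<k}s_i$, $v$ the number of nonzero symbols among $s_1,\dots,s_{k-1}$: $\mathbf s\prec\mathbf t$ iff ($u$ even and $s_k<t_k$) or ($u$ odd and $s_k>t_k$); $\mathbf s\triangleleft\mathbf t$ iff ($u+v$ even and $s_k<t_k$) or ($u+v$ odd and $s_k>t_k$). -}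

module Defs where

open import Data.Nat using (ℕ; zero; suc; _+_; _<_; _≤_)
open import Data.Nat.Properties using (_≟_)
open import Data.Fin using (Fin; toℕ)
open import Data.Fin.Properties using () renaming (_≟_ to _≟ᶠ_)
open import Data.Vec using (Vec; lookup; toList)
open import Data.List as List using (List; []; _∷_; _++_; length; take; map; filter)
open import Data.Nat.ListAction using (sum)
open import Data.Product using (Σ; ∃; _×_; _,_)
open import Data.Sum using (_⊎_)
open import Relation.Nullary using (¬_)
open import Relation.Binary.PropositionalEquality using (_≡_; _≢_)
open import Relation.Nullary.Decidable using (¬?)
open import Data.Nat using (_%_)

-- A word of length n over A_q is a Vec (Fin q) n; A_q^+ words are nonempty lists.

IsFactor : ∀ {q} → List (Fin q) → List (Fin q) → Set
IsFactor {q} f w = Σ (List (Fin q)) λ x → Σ (List (Fin q)) λ y → w ≡ x ++ f ++ y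

Avoids : ∀ {q n} → List (Fin q) → Vec (Fin q) n → Set
Avoids f w = ¬ IsFactor f (toList w)

LeftmostDiff : ∀ {q n} → Vec (Fin q) n → Vec (Fin q) n → Fin n → Set
LeftmostDiff s t k =
  ((i : Fin _) → toℕ i < toℕ k → lookup s i ≡ lookup t i) × lookup s k ≢ lookup t k

prefixSum : ∀ {q n} → Vec (Fin q) n → Fin n → ℕ
prefixSum s k = sum (map toℕ (take (toℕ k) (toList s)))

prefixNonzero : ∀ {q n} → Vec (Fin q) n → Fin n → ℕ
prefixNonzero s k = length (filter (λ x → ¬? (toℕ x ≟ 0)) (take (toℕ k) (toList s)))

Even : ℕ → Set
Even m = m % 2 ≡ 0

Odd : ℕ → Set
Odd m = m % 2 ≡ 1

_≺_ : ∀ {q n} → Vec (Fin q) n → Vec (Fin q) n → Set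
_≺_ {q} {n} s t = Σ (Fin n) λ k → LeftmostDiff s t k ×
  ((Even (prefixSum s k) × toℕ (lookup s k) < toℕ (lookup t k))
   ⊎ (Odd (prefixSum s k) × toℕ (lookup t k) < toℕ (lookup s k)))

_◁_ : ∀ {q n} → Vec (Fin q) n → Vec (Fin q) n → Set
_◁_ {q} {n} s t = Σ (Fin n) λ k → LeftmostDiff s t k ×
  ((Even (prefixSum s k + prefixNonzero s k) × toℕ (lookup s k) < toℕ (lookup t k))
   ⊎ (Odd (prefixSum s k + prefixNonzero s k) × toℕ (lookup t k) < toℕ (lookup s k)))

Consecutive : ∀ {q n} → (Vec (Fin q) n → Vec (Fin q) n → Set) → List (Fin q)
            → Vec (Fin q) n → Vec (Fin q) n → Set
Consecutive {q} {n} R f a b =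
  Avoids f a × Avoids f b × R a b ×
  ((c : Vec (Fin q) n) → Avoids f c → ¬ (R a c × R c b))

module Submission where

-- Both orders ≺ and ◁ compare two words at their leftmost
-- differing position k, in increasing or decreasing direction according to
-- the parity of a statistic of the common prefix s₁⋯s_{k-1}.  So we treat
-- one generic "prefix-parity order" OrdBy Q, for an arbitrary statistic Q of
-- the prefix; ≺ and ◁ are OrdBy of two specific statistics.
--
-- Suppose a, b are consecutive for OrdBy Q among the words avoiding f, with
-- f ending in x ∈ {0, q-1}, and that a_k, b_k are not adjacent.  Pick a
-- symbol m strictly between them; it is neither 0 nor q-1, so m ≠ x.  Let
-- c = a₁⋯a_{k-1} m m ⋯ m.  Any occurrence of f in c ends in x ≠ m, hence
-- lies inside a₁⋯a_{k-1}, i.e. inside a; so c avoids f.  Since c shares the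
-- prefix of a (and b) before k, the same parity decides both comparisons,
-- giving a < c < b — contradicting consecutiveness.

open import Defs
open import Data.Nat using (ℕ; suc; _≤_; _<_; _+_; s≤s; z≤n)
open import Data.Nat.Properties using (≤∧≢⇒<; <-irrefl; <-cmp; <-trans; ≤-<-trans; ≤-refl)
  renaming (_≟_ to _≟ℕ_)
open import Data.Nat.ListAction using (sum)
open import Data.Fin using (Fin; zero; suc; toℕ; fromℕ<)
open import Data.Fin.Properties using (toℕ-fromℕ<; toℕ-injective; toℕ<n)
open import Data.Vec using (Vec; _∷_; lookup; replicate; toList)
open import Data.Vec.Properties using (toList-replicate)
open import Data.List as List using (List; []; _∷_; _++_; take; drop; length; map; filter)
open import Data.List.Properties using (take++drop≡id; ++-assoc; ∷-injectiveˡ; ∷-injectiveʳ)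
open import Data.List.Relation.Unary.All using (All; head)
open import Data.List.Relation.Unary.All.Properties using (++⁻ʳ; replicate⁺)
open import Data.Product using (Σ; _×_; _,_)
open import Data.Sum using (_⊎_; inj₁; inj₂)
open import Data.Empty using (⊥-elim)
open import Function using (_∘_)
open import Relation.Nullary using (yes; no)
open import Relation.Nullary.Decidable using (¬?)
open import Relation.Binary.PropositionalEquality
  using (_≡_; _≢_; refl; sym; trans; cong; subst)
open import Relation.Binary.Definitions using (tri<; tri≈; tri>)

leftmostDiff-unique : ∀ {q n} {s t : Vec (Fin q) n} {k k′ : Fin n} →
  LeftmostDiff s t k → LeftmostDiff s t k′ → k′ ≡ k
leftmostDiff-unique {k = k} {k′} (agree , differ) (agree′ , differ′)
  with <-cmp (toℕ k) (toℕ k′)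
... | tri< k<k′ _ _ = ⊥-elim (differ (agree′ k k<k′))
... | tri≈ _ k≡k′ _ = toℕ-injective (sym k≡k′)
... | tri> _ _ k′<k = ⊥-elim (differ′ (agree k′ k′<k))

padFrom : ∀ {A : Set} {n} → Vec A n → Fin n → A → Vec A n
padFrom (_ ∷ _)  zero    m = m ∷ replicate _ m
padFrom (y ∷ ys) (suc k) m = y ∷ padFrom ys k m

padFrom-before : ∀ {A : Set} {n} (a : Vec A n) k m (i : Fin n) →
  toℕ i < toℕ k → lookup (padFrom a k m) i ≡ lookup a i
padFrom-before (y ∷ ys) (suc k) m zero    _       = refl
padFrom-before (y ∷ ys) (suc k) m (suc i) (s≤s i<k) = padFrom-before ys k m i i<k

padFrom-at : ∀ {A : Set} {n} (a : Vec A n) k m → lookup (padFrom a k m) k ≡ m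
padFrom-at (_ ∷ _)  zero    m = refl
padFrom-at (y ∷ ys) (suc k) m = padFrom-at ys k m

-- The prefix before k, on which the comparison parity depends, is a's.
padFrom-prefix : ∀ {A : Set} {n} (a : Vec A n) k m →
  take (toℕ k) (toList (padFrom a k m)) ≡ take (toℕ k) (toList a)
padFrom-prefix (_ ∷ _)  zero    m = refl
padFrom-prefix (y ∷ ys) (suc k) m = cong (y ∷_) (padFrom-prefix ys k m)

padFrom-toList : ∀ {A : Set} {n} (a : Vec A n) k m →
  Σ ℕ λ r → toList (padFrom a k m) ≡ take (toℕ k) (toList a) ++ List.replicate r m
padFrom-toList (_ ∷ _)  zero    m = _ , cong (m ∷_) (toList-replicate _ m)
padFrom-toList (y ∷ ys) (suc k) m with padFrom-toList ys k m
... | r , eq = r , cong (y ∷_) eq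

occurrence-ends-in-prefix : ∀ {A : Set} {x : A} (p r s Z Y : List A) →
  All (_≢ x) r → p ++ r ≡ Z ++ x ∷ Y → Σ (List A) λ Y′ → p ++ s ≡ Z ++ x ∷ Y′
occurrence-ends-in-prefix [] r s Z Y no-x eq =
  ⊥-elim (head (++⁻ʳ Z (subst (All _) eq no-x)) refl)
occurrence-ends-in-prefix (e ∷ p) r s [] Y no-x eq = p ++ s , cong (_∷ _) (∷-injectiveˡ eq)
occurrence-ends-in-prefix (e ∷ p) r s (z ∷ Z) Y no-x eq
  with occurrence-ends-in-prefix p r s Z Y no-x (∷-injectiveʳ eq)
... | Y′ , eq′ = Y′ , trans (cong (_∷ _) (∷-injectiveˡ eq)) (cong (z ∷_) eq′)

-- An occurrence of g ++ [x] in w is an occurrence of "something ending in x".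
reassociate : ∀ {A : Set} (X g : List A) x Y → X ++ (g ++ x ∷ []) ++ Y ≡ (X ++ g) ++ x ∷ Y
reassociate X g x Y = trans (cong (X ++_) (++-assoc g (x ∷ []) Y)) (sym (++-assoc X g (x ∷ Y)))

padFrom-avoids : ∀ {q n} (g : List (Fin q)) x (a : Vec (Fin q) n) k m →
  Avoids (g ++ x ∷ []) a → m ≢ x → Avoids (g ++ x ∷ []) (padFrom a k m)
padFrom-avoids g x a k m a-avoids m≢x (X , Y , occ) with padFrom-toList a k m
... | r , as-list
  with occurrence-ends-in-prefix (take (toℕ k) (toList a)) (List.replicate r m)
         (drop (toℕ k) (toList a)) (X ++ g) Y (replicate⁺ r m≢x)
         (trans (sym as-list) (trans occ (reassociate X g x Y)))
... | Y′ , occ′ = a-avoids (X , Y′ , occ-in-a)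
  where
  occ-in-a : toList a ≡ X ++ (g ++ x ∷ []) ++ Y′
  occ-in-a = trans (sym (take++drop≡id (toℕ k) (toList a)))
                 (trans occ′ (sym (reassociate X g x Y′)))

Towards : ℕ → ℕ → ℕ → Set
Towards e u v = (Even e × u < v) ⊎ (Odd e × v < u)

towards-≢ : ∀ {q} e {u v : Fin q} → Towards e (toℕ u) (toℕ v) → u ≢ v
towards-≢ _ (inj₁ (_ , u<v)) u≡v = <-irrefl (cong toℕ u≡v) u<v
towards-≢ _ (inj₂ (_ , v<u)) u≡v = <-irrefl (cong toℕ (sym u≡v)) v<u

OrdBy : ∀ {q} → (List (Fin q) → ℕ) → ∀ {n} → Vec (Fin q) n → Vec (Fin q) n → Set
OrdBy Q {n} s t = Σ (Fin n) λ k → LeftmostDiff s t k ×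
  Towards (Q (take (toℕ k) (toList s))) (toℕ (lookup s k)) (toℕ (lookup t k))

Interior : ∀ {q} → Fin q → Set
Interior {q} m = 0 < toℕ m × suc (toℕ m) < q

interior-≢-extreme : ∀ {q} {m x : Fin q} → Interior m →
  (toℕ x ≡ 0) ⊎ (suc (toℕ x) ≡ q) → m ≢ x
interior-≢-extreme (0<m , _)   (inj₁ x≡0)   refl = <-irrefl (sym x≡0) 0<m
interior-≢-extreme (_ , m+1<q) (inj₂ x+1≡q) refl = <-irrefl x+1≡q m+1<q

Adjacent : ℕ → ℕ → Set
Adjacent u v = (v ≡ suc u) ⊎ (suc v ≡ u)

interiorBetween : ∀ {q} lo hi → suc lo < hi → hi < q →
  Σ (Fin q) λ m → Interior m × lo < toℕ m × toℕ m < hi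
interiorBetween {q} lo hi lo+1<hi hi<q = m , subst Good (sym (toℕ-fromℕ< lo+1<q)) lo+1-good
  where
  lo+1<q : suc lo < q
  lo+1<q = <-trans lo+1<hi hi<q
  m : Fin q
  m = fromℕ< lo+1<q
  Good : ℕ → Set
  Good j = (0 < j × suc j < q) × lo < j × j < hi
  lo+1-good : Good (suc lo)
  lo+1-good = (s≤s z≤n , ≤-<-trans lo+1<hi hi<q) , ≤-refl , lo+1<hi

adjacent-or-gap : ∀ {q} e (u v : Fin q) → Towards e (toℕ u) (toℕ v) →
  Adjacent (toℕ u) (toℕ v) ⊎
  (Σ (Fin q) λ m → Interior m × Towards e (toℕ u) (toℕ m) × Towards e (toℕ m) (toℕ v))
adjacent-or-gap e u v (inj₁ (even , u<v)) with toℕ v ≟ℕ suc (toℕ u)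
... | yes adjacent = inj₁ (inj₁ adjacent)
... | no ¬adjacent
  with interiorBetween (toℕ u) (toℕ v) (≤∧≢⇒< u<v (¬adjacent ∘ sym)) (toℕ<n v)
...   | m , interior , u<m , m<v = inj₂ (m , interior , inj₁ (even , u<m) , inj₁ (even , m<v))
adjacent-or-gap e u v (inj₂ (odd , v<u)) with suc (toℕ v) ≟ℕ toℕ u
... | yes adjacent = inj₁ (inj₂ adjacent)
... | no ¬adjacent
  with interiorBetween (toℕ v) (toℕ u) (≤∧≢⇒< v<u ¬adjacent) (toℕ<n u)
...   | m , interior , v<m , m<u = inj₂ (m , interior , inj₂ (odd , m<u) , inj₂ (odd , v<m))

padFrom-between : ∀ {q n} (Q : List (Fin q) → ℕ) (a b : Vec (Fin q) n) k m →
  LeftmostDiff a b k →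
  Towards (Q (take (toℕ k) (toList a))) (toℕ (lookup a k)) (toℕ m) →
  Towards (Q (take (toℕ k) (toList a))) (toℕ m) (toℕ (lookup b k)) →
  OrdBy Q a (padFrom a k m) × OrdBy Q (padFrom a k m) b
padFrom-between Q a b k m (agree , _) a→m m→b =
  (k , ((λ i i<k → sym (padFrom-before a k m i i<k)) , towards-≢ e a→c) , a→c) ,
  (k , ((λ i i<k → trans (padFrom-before a k m i i<k) (agree i i<k)) , towards-≢ (Q (take (toℕ k) (toList c))) c→b) , c→b)
  where
  c = padFrom a k m
  e = Q (take (toℕ k) (toList a))
  a→c : Towards e (toℕ (lookup a k)) (toℕ (lookup c k))
  a→c = subst (λ y → Towards e (toℕ (lookup a k)) (toℕ y)) (sym (padFrom-at a k m)) a→m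
  c→b : Towards (Q (take (toℕ k) (toList c))) (toℕ (lookup c k)) (toℕ (lookup b k))
  c→b = subst (λ p → Towards (Q p) (toℕ (lookup c k)) (toℕ (lookup b k)))
              (sym (padFrom-prefix a k m))
              (subst (λ y → Towards e (toℕ y) (toℕ (lookup b k))) (sym (padFrom-at a k m)) m→b)

consecutive-adjacent : ∀ {q n} (Q : List (Fin q) → ℕ) (g : List (Fin q)) (x : Fin q) →
  (toℕ x ≡ 0) ⊎ (suc (toℕ x) ≡ q) →
  (a b : Vec (Fin q) n) → Consecutive (OrdBy Q) (g ++ x ∷ []) a b →
  (k : Fin n) → LeftmostDiff a b k → Adjacent (toℕ (lookup a k)) (toℕ (lookup b k))
consecutive-adjacent Q g x x-extreme a b (a-avoids , _ , (k′ , diff′ , a→b) , nothing-between) k diff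
  with leftmostDiff-unique {s = a} {b} diff diff′
... | refl with adjacent-or-gap (Q (take (toℕ k) (toList a))) (lookup a k) (lookup b k) a→b
...   | inj₁ adjacent = adjacent
...   | inj₂ (m , interior , a→m , m→b) =
  ⊥-elim (nothing-between (padFrom a k m)
    (padFrom-avoids g x a k m a-avoids (interior-≢-extreme interior x-extreme))
    (padFrom-between Q a b k m diff a→m m→b))

proposition11 : (q n : ℕ) → 2 ≤ q → 1 ≤ n →
    (g : List (Fin q)) → (x : Fin q) →
    (toℕ x ≡ 0) ⊎ (suc (toℕ x) ≡ q) →
    (a b : Vec (Fin q) n) →
    (Consecutive _≺_ (g ++ (x ∷ [])) a b ⊎ Consecutive _◁_ (g ++ (x ∷ [])) a b) →
    (k : Fin n) → LeftmostDiff a b k →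
    (toℕ (lookup b k) ≡ suc (toℕ (lookup a k))) ⊎ (suc (toℕ (lookup b k)) ≡ toℕ (lookup a k))
proposition11 q n _ _ g x x-extreme a b (inj₁ consecutive-≺) =
  consecutive-adjacent (λ p → sum (map toℕ p)) g x x-extreme a b consecutive-≺
proposition11 q n _ _ g x x-extreme a b (inj₂ consecutive-◁) =
  consecutive-adjacent (λ p → sum (map toℕ p) + length (filter (λ y → ¬? (toℕ y ≟ℕ 0)) p))
    g x x-extreme a b consecutive-◁
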